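{- Let $q$ be an odd positive integer, and write $q=q_1^2q_0$ where $q_0$ is square-free. If $x\geq q^2$, then $$\sum_{n\leq x}\left(\frac{4n^2+1}{q}\right)\ll \frac{x}{q_0},$$ where the sum is over positive integers $n\leq x$ and the implied constant is absolute.
   Context: $\left(\frac{\cdot}{q}\right)$ denotes the Jacobi symbol modulo $q$. -}

module Defs where

open import Data.Nat using (ℕ; zero; suc; _+_; _*_; _^_; _≤?_; _≟_)
open import Data.Nat.DivMod using (_/_; _%_)
open import Data.Nat.Divisibility using (_∣_; _∣?_)
open import Data.Integer as ℤ using (ℤ)
open import Data.List using (List; map; upTo; foldr)
open import Data.List.Relation.Unary.Any using (any?)
open import Relation.Nullary using (yes; no)
open import Relation.Binary.PropositionalEquality using (_≡_)

Odd : ℕ → Set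
Odd q = q % 2 ≡ 1

SquareFree : ℕ → Set
SquareFree n = ∀ d → d * d ∣ n → d ≡ 1

legendre : ℕ → ℕ → ℤ
legendre a zero = ℤ.0ℤ
legendre a (suc p') with suc p' ∣? a
... | yes _ = ℤ.0ℤ
... | no _ with any? (λ y → ((y * y) % suc p') ≟ (a % suc p')) (upTo (suc p'))
...   | yes _ = ℤ.1ℤ
...   | no _ = ℤ.-1ℤ

-- smallest divisor d' ≥ d of q (searching with fuel); for q ≥ 2 and
-- enough fuel, started at d = 2, this is the smallest prime factor of q
smallestFactor : ℕ → ℕ → ℕ → ℕ
smallestFactor zero d q = q
smallestFactor (suc f) d q with d ∣? q
... | yes _ = d
... | no _ = smallestFactor f (suc d) q

-- Jacobi symbol via prime factorisation: (a/q) = ∏ (a/p) over the prime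
-- factors p of q with multiplicity; (a/1) = 1.  Fuel q is sufficient.
jacobiAux : ℕ → ℕ → ℕ → ℤ
jacobiAux zero a q = ℤ.1ℤ
jacobiAux (suc f) a q with 2 ≤? q
... | no _ = ℤ.1ℤ
... | yes _ with smallestFactor q 2 q
...   | zero = ℤ.1ℤ
...   | suc p' = legendre a (suc p') ℤ.* jacobiAux f a (q / suc p')

jacobi : ℕ → ℕ → ℤ
jacobi a q = jacobiAux q a q

charSum : ℕ → ℕ → ℤ
charSum x q = foldr ℤ._+_ ℤ.0ℤ (map (λ n → jacobi (4 * n ^ 2 + 1) q) (map suc (upTo x)))

-- Let P(q) = Σ_{n<q} ((4n²+1)/q) be the complete sum. The summand is q-periodic, so the sum
-- over n ≤ x is ⌊x/q⌋·P(q) plus fewer than q terms of size at most 1; hence it suffices to show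
-- |P(q)|·q₀ ≤ q, and then x ≥ q² gives the bound with C = 2.
--
-- For q = p^k m with p the smallest prime factor of q, multiplicativity of the Jacobi symbol and the
-- Chinese remainder theorem give P(q) = p^(k-1)·L_k(p)·P(m), where L_k(p) = Σ_{n<p} ((4n²+1)/p)^k,
-- so |L_k(p)| ≤ p. For odd k, L_k(p) = Σ_{n<p} ((4n²+1)/p) = -1, because y² − 4n² = (y − 2n)(y + 2n)
-- shows that y² ≡ 4n² + 1 (mod p) has exactly p − 1 solutions (n, y). Since p divides q₀ only when
-- k is odd, induction on q gives |P(q)|·q₀ ≤ q.

module Submission where

open import Defs
open import Data.Nat.Base
open import Data.Nat.Properties
open import Data.Nat.DivMod
open import Data.Nat.Divisibility
open import Data.Nat.Coprimality using (Coprime; coprime-Bézout; coprime-divisor; prime⇒coprime)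
open import Data.Nat.GCD using (module Bézout)
open import Data.Nat.Primality
open import Data.Nat.Tactic.RingSolver using (solve-∀)
import Data.Integer.Tactic.RingSolver as ℤ-Solver
open import Data.Integer.Base as ℤ using (ℤ; 0ℤ; 1ℤ; -1ℤ; ∣_∣)
import Data.Integer.Properties as ℤ
open import Data.Product using (∃₂; ∃-syntax; _×_; _,_; proj₁; proj₂)
open import Data.Sum using (_⊎_; inj₁; inj₂)
open import Data.List.Base using (upTo; applyUpTo; map; foldr)
open import Data.List.Relation.Unary.Any using (any?)
import Data.List.Relation.Unary.Any as Any
open import Data.List.Membership.Propositional using (find; lose)
open import Data.List.Membership.Propositional.Properties using (∈-upTo⁺; ∈-upTo⁻)
open import Data.Nat.Induction using (<-rec)
open import Data.Empty using (⊥-elim)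
open import Relation.Nullary using (Dec; yes; no; ¬_; contradiction)
open import Relation.Nullary.Decidable using (map′; _×-dec_)
open import Function.Base using (_∘_; id)
open import Relation.Binary.Bundles using (Setoid)
open import Relation.Binary.Definitions using (tri<; tri≈; tri>)
open import Relation.Binary.PropositionalEquality
import Relation.Binary.Reasoning.Setoid as SetoidReasoning

-- Finite sums

sum : ℕ → (ℕ → ℤ) → ℤ
sum zero    f = 0ℤ
sum (suc n) f = f 0 ℤ.+ sum n (λ i → f (suc i))

indicator : {P : Set} → Dec P → ℤ
indicator (yes _) = 1ℤ
indicator (no _)  = 0ℤ

indicator-yes : {P : Set} (d : Dec P) → P → indicator d ≡ 1ℤ
indicator-yes (yes _) _ = refl
indicator-yes (no ¬p) p = ⊥-elim (¬p p)

indicator-no : {P : Set} (d : Dec P) → ¬ P → indicator d ≡ 0ℤ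
indicator-no (yes p) ¬p = ⊥-elim (¬p p)
indicator-no (no _)  _  = refl

indicator-cong : {P Q : Set} (d : Dec P) (e : Dec Q) → (P → Q) → (Q → P) → indicator d ≡ indicator e
indicator-cong d (yes q) _   Q⇒P = indicator-yes d (Q⇒P q)
indicator-cong d (no ¬q) P⇒Q _   = indicator-no d (λ p → ¬q (P⇒Q p))

sum-cong : ∀ n {f g} → (∀ i → i < n → f i ≡ g i) → sum n f ≡ sum n g
sum-cong zero    _ = refl
sum-cong (suc n) f≗g = cong₂ ℤ._+_ (f≗g 0 z<s) (sum-cong n (λ i i<n → f≗g (suc i) (s<s i<n)))

sum-+-split : ∀ m n f → sum (m + n) f ≡ sum m f ℤ.+ sum n (λ i → f (m + i))
sum-+-split zero    n f = sym (ℤ.+-identityˡ _)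
sum-+-split (suc m) n f =
  trans (cong (λ s → f 0 ℤ.+ s) (sum-+-split m n (λ i → f (suc i)))) (sym (ℤ.+-assoc (f 0) _ _))

sum-distrib-+ : ∀ n f g → sum n (λ i → f i ℤ.+ g i) ≡ sum n f ℤ.+ sum n g
sum-distrib-+ zero    f g = refl
sum-distrib-+ (suc n) f g =
  trans (cong (λ s → f 0 ℤ.+ g 0 ℤ.+ s) (sum-distrib-+ n (λ i → f (suc i)) (λ i → g (suc i))))
        (interchange (f 0) (g 0) _ _)
  where
  interchange : ∀ a b c d → a ℤ.+ b ℤ.+ (c ℤ.+ d) ≡ a ℤ.+ c ℤ.+ (b ℤ.+ d)
  interchange = ℤ-Solver.solve-∀

sum-*ˡ : ∀ n c f → sum n (λ i → c ℤ.* f i) ≡ c ℤ.* sum n f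
sum-*ˡ zero    c f = sym (ℤ.*-zeroʳ c)
sum-*ˡ (suc n) c f =
  trans (cong (λ s → c ℤ.* f 0 ℤ.+ s) (sum-*ˡ n c (λ i → f (suc i)))) (sym (ℤ.*-distribˡ-+ c _ _))

sum-const : ∀ n c → sum n (λ _ → c) ≡ ℤ.+ n ℤ.* c
sum-const zero    c = sym (ℤ.*-zeroˡ c)
sum-const (suc n) c = begin
  c ℤ.+ sum n (λ _ → c)     ≡⟨ cong (ℤ._+_ c) (sum-const n c) ⟩
  c ℤ.+ ℤ.+ n ℤ.* c         ≡⟨ cong (ℤ._+ ℤ.+ n ℤ.* c) (ℤ.*-identityˡ c) ⟨
  1ℤ ℤ.* c ℤ.+ ℤ.+ n ℤ.* c  ≡⟨ ℤ.*-distribʳ-+ c 1ℤ (ℤ.+ n) ⟨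
  ℤ.+ suc n ℤ.* c           ∎
  where open ≡-Reasoning

sum-zero : ∀ n f → (∀ i → i < n → f i ≡ 0ℤ) → sum n f ≡ 0ℤ
sum-zero n f f≗0 = trans (sum-cong n f≗0) (trans (sum-const n 0ℤ) (ℤ.*-zeroʳ (ℤ.+ n)))

sum-single : ∀ n f j → j < n → (∀ i → i < n → i ≢ j → f i ≡ 0ℤ) → sum n f ≡ f j
sum-single (suc n) f zero    _ f≗0 =
  trans (cong (λ s → f 0 ℤ.+ s) (sum-zero n _ (λ i i<n → f≗0 (suc i) (s<s i<n) (λ ())))) (ℤ.+-identityʳ _)
sum-single (suc n) f (suc j) (s<s j<n) f≗0 =
  trans (cong₂ ℤ._+_ (f≗0 0 z<s (λ ()))
                     (sum-single n _ j j<n (λ i i<n i≢j → f≗0 (suc i) (s<s i<n) (i≢j ∘ suc-injective))))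
        (ℤ.+-identityˡ _)

sum-pair : ∀ n f j k → j < n → k < n → j ≢ k →
           (∀ i → i < n → i ≢ j → i ≢ k → f i ≡ 0ℤ) → sum n f ≡ f j ℤ.+ f k
sum-pair (suc n) f zero zero _ _ j≢k _ = ⊥-elim (j≢k refl)
sum-pair (suc n) f zero (suc k) _ (s<s k<n) _ f≗0 =
  cong (λ s → f 0 ℤ.+ s)
       (sum-single n _ k k<n (λ i i<n i≢k → f≗0 (suc i) (s<s i<n) (λ ()) (i≢k ∘ suc-injective)))
sum-pair (suc n) f (suc j) zero (s<s j<n) _ _ f≗0 =
  trans (cong (λ s → f 0 ℤ.+ s)
              (sum-single n _ j j<n (λ i i<n i≢j → f≗0 (suc i) (s<s i<n) (i≢j ∘ suc-injective) (λ ()))))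
        (ℤ.+-comm (f 0) _)
sum-pair (suc n) f (suc j) (suc k) (s<s j<n) (s<s k<n) j≢k f≗0 =
  trans (cong₂ ℤ._+_ (f≗0 0 z<s (λ ()) (λ ()))
                     (sum-pair n _ j k j<n k<n (j≢k ∘ cong suc) (λ i i<n i≢j i≢k →
                       f≗0 (suc i) (s<s i<n) (i≢j ∘ suc-injective) (i≢k ∘ suc-injective))))
        (ℤ.+-identityˡ _)

sum-comm : ∀ m n (f : ℕ → ℕ → ℤ) → sum m (λ i → sum n (f i)) ≡ sum n (λ j → sum m (λ i → f i j))
sum-comm zero    n f = sym (sum-zero n _ (λ _ _ → refl))
sum-comm (suc m) n f =
  trans (cong (λ s → sum n (f 0) ℤ.+ s) (sum-comm m n (λ i → f (suc i))))
        (sym (sum-distrib-+ n (f 0) (λ j → sum m (λ i → f (suc i) j))))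

sum-blocks : ∀ a b f → sum (a * b) f ≡ sum a (λ j → sum b (λ r → f (j * b + r)))
sum-blocks zero    b f = refl
sum-blocks (suc a) b f = trans (sum-+-split b (a * b) f)
  (cong (λ s → sum b f ℤ.+ s)
    (trans (sum-blocks a b (λ i → f (b + i)))
           (sum-cong a (λ j _ → sum-cong b (λ r _ → cong f (sym (+-assoc b (j * b) r)))))))

Periodic : ℕ → (ℕ → ℤ) → Set
Periodic c f = ∀ i → f (i + c) ≡ f i

sum-periodic : ∀ t c f → Periodic c f → sum (t * c) f ≡ ℤ.+ t ℤ.* sum c f
sum-periodic t c f per = trans (sum-blocks t c f)
  (trans (sum-cong t (λ j _ → sum-cong c (λ r _ → shift j r))) (sum-const t (sum c f)))
  where
  shift : ∀ j r → f (j * c + r) ≡ f r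
  shift zero    r = refl
  shift (suc j) r = trans (cong f (trans (+-assoc c (j * c) r) (+-comm c _))) (trans (per _) (shift j r))

sum-rotate : ∀ c f → Periodic c f → sum c (λ i → f (suc i)) ≡ sum c f
sum-rotate zero    f per = refl
sum-rotate (suc c) f per = begin
  sum (suc c) (λ i → f (suc i))                          ≡⟨ cong (λ k → sum k (λ i → f (suc i))) (+-comm 1 c) ⟩
  sum (c + 1) (λ i → f (suc i))                          ≡⟨ sum-+-split c 1 (λ i → f (suc i)) ⟩
  sum c (λ i → f (suc i)) ℤ.+ (f (suc (c + 0)) ℤ.+ 0ℤ)   ≡⟨ cong (ℤ._+_ (sum c (λ i → f (suc i)))) last≡f0 ⟩
  sum c (λ i → f (suc i)) ℤ.+ f 0                        ≡⟨ ℤ.+-comm _ (f 0) ⟩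
  sum (suc c) f                                          ∎
  where
  open ≡-Reasoning
  last≡f0 : f (suc (c + 0)) ℤ.+ 0ℤ ≡ f 0
  last≡f0 = trans (ℤ.+-identityʳ _) (trans (cong (f ∘ suc) (+-identityʳ c)) (per 0))

∣sum∣≤ : ∀ n f → (∀ i → i < n → ∣ f i ∣ ≤ 1) → ∣ sum n f ∣ ≤ n
∣sum∣≤ zero    f _  = z≤n
∣sum∣≤ (suc n) f ∣f∣≤1 = ≤-trans (ℤ.∣i+j∣≤∣i∣+∣j∣ (f 0) _)
  (+-mono-≤ (∣f∣≤1 0 z<s) (∣sum∣≤ n _ (λ i i<n → ∣f∣≤1 (suc i) (s<s i<n))))

sum-indicator-unique : ∀ n {P : ℕ → Set} (P? : ∀ i → Dec (P i)) {j} → j < n → P j →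
                       (∀ {i} → i < n → P i → i ≡ j) → sum n (λ i → indicator (P? i)) ≡ 1ℤ
sum-indicator-unique n P? {j} j<n Pj unique =
  trans (sum-single n _ j j<n (λ i i<n i≢j → indicator-no (P? i) (i≢j ∘ unique i<n))) (indicator-yes (P? j) Pj)

-- Congruences

module Congruence (m : ℕ) .{{_ : NonZero m}} where

  -- A record rather than an equation of remainders, so that x and y are inferable from a proof.
  infix 4 _≈_
  record _≈_ (x y : ℕ) : Set where
    constructor mk
    field un : x % m ≡ y % m
  open _≈_ public

  ≈-refl : ∀ {x} → x ≈ x
  ≈-refl = mk refl

  ≈-sym : ∀ {x y} → x ≈ y → y ≈ x
  ≈-sym (mk e) = mk (sym e)

  ≈-trans : ∀ {x y z} → x ≈ y → y ≈ z → x ≈ z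
  ≈-trans (mk e) (mk f) = mk (trans e f)

  ≡⇒≈ : ∀ {x y} → x ≡ y → x ≈ y
  ≡⇒≈ refl = ≈-refl

  infix 4 _≈?_
  _≈?_ : ∀ x y → Dec (x ≈ y)
  x ≈? y = map′ mk un (x % m ≟ y % m)

  ≈-setoid : Setoid _ _
  ≈-setoid = record
    { Carrier = ℕ ; _≈_ = _≈_
    ; isEquivalence = record { refl = ≈-refl ; sym = ≈-sym ; trans = ≈-trans } }

  module ≈-Reasoning = SetoidReasoning ≈-setoid

  ≈-+ : ∀ {x x′ y y′} → x ≈ x′ → y ≈ y′ → x + y ≈ x′ + y′
  ≈-+ {x} {x′} {y} {y′} (mk e) (mk f) = mk (begin
    (x + y) % m               ≡⟨ %-distribˡ-+ x y m ⟩
    (x % m + y % m) % m       ≡⟨ cong₂ (λ u v → (u + v) % m) e f ⟩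
    (x′ % m + y′ % m) % m     ≡⟨ %-distribˡ-+ x′ y′ m ⟨
    (x′ + y′) % m             ∎)
    where open ≡-Reasoning

  ≈-* : ∀ {x x′ y y′} → x ≈ x′ → y ≈ y′ → x * y ≈ x′ * y′
  ≈-* {x} {x′} {y} {y′} (mk e) (mk f) = mk (begin
    (x * y) % m               ≡⟨ %-distribˡ-* x y m ⟩
    (x % m * (y % m)) % m     ≡⟨ cong₂ (λ u v → (u * v) % m) e f ⟩
    (x′ % m * (y′ % m)) % m   ≡⟨ %-distribˡ-* x′ y′ m ⟨
    (x′ * y′) % m             ∎)
    where open ≡-Reasoning

  ≈-+ˡ : ∀ {x x′} y → x ≈ x′ → y + x ≈ y + x′
  ≈-+ˡ y = ≈-+ (≈-refl {y})

  ≈-+ʳ : ∀ {x x′} y → x ≈ x′ → x + y ≈ x′ + y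
  ≈-+ʳ y e = ≈-+ e (≈-refl {y})

  ≈-*ˡ : ∀ {x x′} y → x ≈ x′ → y * x ≈ y * x′
  ≈-*ˡ y = ≈-* (≈-refl {y})

  ≈-*ʳ : ∀ {x x′} y → x ≈ x′ → x * y ≈ x′ * y
  ≈-*ʳ y e = ≈-* e (≈-refl {y})

  %-≈ : ∀ x → x % m ≈ x
  %-≈ x = mk (m%n%n≡m%n x m)

  +-multiple-≈ : ∀ x k → x + k * m ≈ x
  +-multiple-≈ x k = mk ([m+kn]%n≡m%n x k m)

  ≈-<-injective : ∀ {x y} → x < m → y < m → x ≈ y → x ≡ y
  ≈-<-injective x<m y<m (mk e) = trans (sym (m<n⇒m%n≡m x<m)) (trans e (m<n⇒m%n≡m y<m))

  ≈0⇒∣ : ∀ {x} → x ≈ 0 → m ∣ x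
  ≈0⇒∣ {x} (mk e) = m%n≡0⇒n∣m x m (trans e (m<n⇒m%n≡m (>-nonZero⁻¹ m)))

  ∣⇒≈0 : ∀ {x} → m ∣ x → x ≈ 0
  ∣⇒≈0 (divides k refl) = +-multiple-≈ 0 k

  neg : ℕ → ℕ
  neg k = m ∸ k % m

  +-neg-≈0 : ∀ k → k + neg k ≈ 0
  +-neg-≈0 k = ≈-trans (≡⇒≈ split) (+-multiple-≈ 0 (suc (k / m)))
    where
    split : k + neg k ≡ suc (k / m) * m
    split = begin
      k + (m ∸ k % m)                     ≡⟨ cong (_+ (m ∸ k % m)) (m≡m%n+[m/n]*n k m) ⟩
      k % m + k / m * m + (m ∸ k % m)     ≡⟨ swap (k % m) (k / m * m) (m ∸ k % m) ⟩
      k / m * m + (k % m + (m ∸ k % m))   ≡⟨ cong (k / m * m +_) (m+[n∸m]≡n (m%n≤n k m)) ⟩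
      k / m * m + m                       ≡⟨ +-comm (k / m * m) m ⟩
      suc (k / m) * m                     ∎
      where
      open ≡-Reasoning
      swap : ∀ a b c → a + b + c ≡ b + (a + c)
      swap = solve-∀

  ≈-cancelʳ-+ : ∀ {x y} k → x + k ≈ y + k → x ≈ y
  ≈-cancelʳ-+ {x} {y} k x+k≈y+k = begin
    x                   ≡⟨ +-identityʳ x ⟨
    x + 0               ≈⟨ ≈-+ˡ x (+-neg-≈0 k) ⟨
    x + (k + neg k)     ≡⟨ +-assoc x k (neg k) ⟨
    x + k + neg k       ≈⟨ ≈-+ʳ (neg k) x+k≈y+k ⟩
    y + k + neg k       ≡⟨ +-assoc y k (neg k) ⟩
    y + (k + neg k)     ≈⟨ ≈-+ˡ y (+-neg-≈0 k) ⟩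
    y + 0               ≡⟨ +-identityʳ y ⟩
    y                   ∎
    where open ≈-Reasoning

  ≈-cancelˡ-+ : ∀ {x y} k → k + x ≈ k + y → x ≈ y
  ≈-cancelˡ-+ {x} {y} k k+x≈k+y =
    ≈-cancelʳ-+ k (≈-trans (≡⇒≈ (+-comm x k)) (≈-trans k+x≈k+y (≡⇒≈ (+-comm k y))))

  ≈⇒∣∸ : ∀ {x y} → y ≤ x → x ≈ y → m ∣ x ∸ y
  ≈⇒∣∸ {x} {y} y≤x (mk e) = divides (x / m ∸ y / m) (begin
    x ∸ y                                       ≡⟨ cong₂ _∸_ (m≡m%n+[m/n]*n x m) (m≡m%n+[m/n]*n y m) ⟩
    (x % m + x / m * m) ∸ (y % m + y / m * m)   ≡⟨ cong (λ r → (x % m + x / m * m) ∸ (r + y / m * m)) e ⟨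
    (x % m + x / m * m) ∸ (x % m + y / m * m)   ≡⟨ [m+n]∸[m+o]≡n∸o (x % m) _ _ ⟩
    x / m * m ∸ y / m * m                       ≡⟨ *-distribʳ-∸ m (x / m) (y / m) ⟨
    (x / m ∸ y / m) * m                         ∎)
    where open ≡-Reasoning

  ≈-inverse : ∀ {b} → Coprime m b → ∃[ v ] b * v ≈ 1
  ≈-inverse {b} c with coprime-Bézout c
  ... | Bézout.-+ x y eq = y , ≈-trans (≡⇒≈ (trans (*-comm b y) (sym eq))) (+-multiple-≈ 1 x)
  ... | Bézout.+- x y eq = y * (m ∸ 1) , ≈-cancelʳ-+ (x * m) (begin
    b * (y * (m ∸ 1)) + x * m         ≡⟨ cong (b * (y * (m ∸ 1)) +_) eq ⟨
    b * (y * (m ∸ 1)) + (1 + y * b)   ≡⟨ regroup b y (m ∸ 1) ⟩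
    1 + b * y * (1 + (m ∸ 1))         ≡⟨ cong (λ k → 1 + b * y * k) (m+[n∸m]≡n (>-nonZero⁻¹ m)) ⟩
    1 + b * y * m                     ≈⟨ +-multiple-≈ 1 (b * y) ⟩
    1                                 ≈⟨ +-multiple-≈ 1 x ⟨
    1 + x * m                         ∎)
    where
    open ≈-Reasoning
    regroup : ∀ b y k → b * (y * k) + (1 + y * b) ≡ 1 + b * y * (1 + k)
    regroup = solve-∀

  ∣∸⇒≈ : ∀ {x y} → y ≤ x → m ∣ x ∸ y → x ≈ y
  ∣∸⇒≈ {x} {y} y≤x m∣x∸y = begin
    x             ≡⟨ m+[n∸m]≡n y≤x ⟨
    y + (x ∸ y)   ≈⟨ ≈-+ˡ y (∣⇒≈0 m∣x∸y) ⟩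
    y + 0         ≡⟨ +-identityʳ y ⟩
    y             ∎
    where open ≈-Reasoning

  ≈-cancelˡ-* : ∀ {c x y} → Coprime m c → c * x ≈ c * y → x ≈ y
  ≈-cancelˡ-* {c} m⊥c = cancel
    where
    cancel-≥ : ∀ {x y} → y ≤ x → c * x ≈ c * y → x ≈ y
    cancel-≥ {x} {y} y≤x e = ∣∸⇒≈ y≤x (coprime-divisor m⊥c m∣c[x∸y])
      where
      m∣c[x∸y] : m ∣ c * (x ∸ y)
      m∣c[x∸y] = subst (m ∣_) (sym (*-distribˡ-∸ c x y)) (≈⇒∣∸ (*-monoʳ-≤ c y≤x) e)
    cancel : ∀ {x y} → c * x ≈ c * y → x ≈ y
    cancel {x} {y} e with ≤-total y x
    ... | inj₁ y≤x = cancel-≥ y≤x e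
    ... | inj₂ x≤y = ≈-sym (cancel-≥ x≤y (≈-sym e))

  Invariant : (ℕ → ℤ) → Set
  Invariant g = ∀ {x y} → x ≈ y → g x ≡ g y

  sum-residue : ∀ {g} → Invariant g → ∀ x → sum m (λ s → indicator (x ≈? s) ℤ.* g s) ≡ g x
  sum-residue {g} g-inv x = begin
    sum m (λ s → indicator (x ≈? s) ℤ.* g s)
      ≡⟨ sum-single m _ (x % m) (m%n<n x m) off-residue ⟩
    indicator (x ≈? x % m) ℤ.* g (x % m)
      ≡⟨ cong (ℤ._* g (x % m)) (indicator-yes (x ≈? x % m) (≈-sym (%-≈ x))) ⟩
    1ℤ ℤ.* g (x % m)
      ≡⟨ ℤ.*-identityˡ (g (x % m)) ⟩
    g (x % m)
      ≡⟨ g-inv (%-≈ x) ⟩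
    g x ∎
    where
    open ≡-Reasoning
    off-residue : ∀ s → s < m → s ≢ x % m → indicator (x ≈? s) ℤ.* g s ≡ 0ℤ
    off-residue s s<m s≢x = trans (cong (ℤ._* g s) (indicator-no (x ≈? s) x≉s)) (ℤ.*-zeroˡ (g s))
      where
      x≉s : ¬ x ≈ s
      x≉s x≈s = s≢x (≈-<-injective s<m (m%n<n x m) (≈-trans (≈-sym x≈s) (≈-sym (%-≈ x))))

≈-mod-∣ : ∀ {d m} .{{_ : NonZero d}} .{{_ : NonZero m}} → d ∣ m → ∀ {x y} →
          Congruence._≈_ m x y → Congruence._≈_ d x y
≈-mod-∣ {d} {m} d∣m {x} {y} (Congruence.mk e) =
  Congruence.mk (trans (sym (m∣n⇒o%n%m≡o%m d m x d∣m)) (trans (cong (_% d) e) (m∣n⇒o%n%m≡o%m d m y d∣m)))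

-- Chinese remainder theorem for sums

module _ {a b : ℕ} .{{_ : NonZero a}} (a⊥b : Coprime a b) where
  open Congruence a

  affine-injective : ∀ r {j k} → j < a → k < a → j * b + r ≈ k * b + r → j ≡ k
  affine-injective r {j} {k} j<a k<a e = ≈-<-injective j<a k<a (≈-cancelˡ-* a⊥b (begin
    b * j   ≡⟨ *-comm b j ⟩
    j * b   ≈⟨ ≈-cancelʳ-+ r e ⟩
    k * b   ≡⟨ *-comm k b ⟩
    b * k   ∎))
    where open ≈-Reasoning

  affine-surjective : ∀ r s → ∃[ j ] j < a × j * b + r ≈ s
  affine-surjective r s = t * v % a , m%n<n (t * v) a , (begin
    t * v % a * b + r     ≈⟨ ≈-+ʳ r (≈-*ʳ b (%-≈ (t * v))) ⟩
    t * v * b + r         ≡⟨ cong (_+ r) (trans (*-assoc t v b) (cong (t *_) (*-comm v b))) ⟩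
    t * (b * v) + r       ≈⟨ ≈-+ʳ r (≈-*ˡ t bv≈1) ⟩
    t * 1 + r             ≡⟨ regroup s (neg r) r ⟩
    s + (r + neg r)       ≈⟨ ≈-+ˡ s (+-neg-≈0 r) ⟩
    s + 0                 ≡⟨ +-identityʳ s ⟩
    s                     ∎)
    where
    open ≈-Reasoning
    t v : ℕ
    t = s + neg r
    v = proj₁ (≈-inverse a⊥b)
    bv≈1 : b * v ≈ 1
    bv≈1 = proj₂ (≈-inverse a⊥b)
    regroup : ∀ s n r → (s + n) * 1 + r ≡ s + (r + n)
    regroup = solve-∀

  affine-count : ∀ r s → sum a (λ j → indicator (j * b + r ≈? s)) ≡ 1ℤ
  affine-count r s with affine-surjective r s
  ... | j , j<a , hit = sum-indicator-unique a (λ i → i * b + r ≈? s) j<a hit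
                          (λ i<a hit′ → affine-injective r i<a j<a (≈-trans hit′ (≈-sym hit)))

  sum-affine : ∀ {g} → Invariant g → ∀ r → sum a (λ j → g (j * b + r)) ≡ sum a g
  sum-affine {g} g-inv r = begin
    sum a (λ j → g (j * b + r))
      ≡⟨ sum-cong a (λ j _ → sym (sum-residue g-inv (j * b + r))) ⟩
    sum a (λ j → sum a (λ s → indicator (j * b + r ≈? s) ℤ.* g s))
      ≡⟨ sum-comm a a _ ⟩
    sum a (λ s → sum a (λ j → indicator (j * b + r ≈? s) ℤ.* g s))
      ≡⟨ sum-cong a (λ s _ → trans (sum-cong a (λ j _ → ℤ.*-comm _ (g s))) (sum-*ˡ a (g s) _)) ⟩
    sum a (λ s → g s ℤ.* sum a (λ j → indicator (j * b + r ≈? s)))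
      ≡⟨ sum-cong a (λ s _ → trans (cong (ℤ._*_ (g s)) (affine-count r s)) (ℤ.*-identityʳ (g s))) ⟩
    sum a g ∎
    where open ≡-Reasoning

  sum-crt : .{{_ : NonZero b}} → ∀ {g h} → Invariant g → Congruence.Invariant b h →
            sum (a * b) (λ n → g n ℤ.* h n) ≡ sum a g ℤ.* sum b h
  sum-crt {g} {h} g-inv h-inv = begin
    sum (a * b) (λ n → g n ℤ.* h n)
      ≡⟨ sum-blocks a b _ ⟩
    sum a (λ j → sum b (λ r → g (j * b + r) ℤ.* h (j * b + r)))
      ≡⟨ sum-cong a (λ j _ → sum-cong b (λ r _ → cong (ℤ._*_ (g (j * b + r))) (h-inv (reduce j r)))) ⟩
    sum a (λ j → sum b (λ r → g (j * b + r) ℤ.* h r))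
      ≡⟨ sum-comm a b _ ⟩
    sum b (λ r → sum a (λ j → g (j * b + r) ℤ.* h r))
      ≡⟨ sum-cong b (λ r _ → trans (sum-cong a (λ j _ → ℤ.*-comm _ (h r))) (sum-*ˡ a (h r) _)) ⟩
    sum b (λ r → h r ℤ.* sum a (λ j → g (j * b + r)))
      ≡⟨ sum-cong b (λ r _ → trans (cong (ℤ._*_ (h r)) (sum-affine g-inv r)) (ℤ.*-comm (h r) _)) ⟩
    sum b (λ r → sum a g ℤ.* h r)
      ≡⟨ sum-*ˡ b (sum a g) h ⟩
    sum a g ℤ.* sum b h ∎
    where
    open ≡-Reasoning
    reduce : ∀ j r → Congruence._≈_ b (j * b + r) r
    reduce j r = Congruence.≈-trans b (Congruence.≡⇒≈ b (+-comm (j * b) r)) (Congruence.+-multiple-≈ b r j)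

-- Smallest prime factors and the Jacobi symbol

≥2⇒nonZero : ∀ {n} → 2 ≤ n → NonZero n
≥2⇒nonZero (s≤s _) = _

∣∧<⇒≡0 : ∀ {m x} → x < m → m ∣ x → x ≡ 0
∣∧<⇒≡0 {x = zero}  _   _   = refl
∣∧<⇒≡0 {x = suc _} x<m m∣x = ⊥-elim (<⇒≱ x<m (∣⇒≤ m∣x))

∣∧<2*⇒≡0⊎≡ : ∀ {m x} → x < m + m → m ∣ x → x ≡ 0 ⊎ x ≡ m
∣∧<2*⇒≡0⊎≡ _ (divides zero refl) = inj₁ refl
∣∧<2*⇒≡0⊎≡ {m} _ (divides (suc zero) refl) = inj₂ (+-identityʳ m)
∣∧<2*⇒≡0⊎≡ {m} x<2m (divides (suc (suc k)) refl) = ⊥-elim (<⇒≱ x<2m (+-monoʳ-≤ m (m≤m+n m (k * m))))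

smallestPrimeFactor : ℕ → ℕ
smallestPrimeFactor n = smallestFactor n 2 n

SmallestFactorOf : ℕ → ℕ → Set
SmallestFactorOf n r = r ∣ n × 2 ≤ r × r Rough n

smallestFactor-spec : ∀ f d n → 2 ≤ n → 2 ≤ d → d Rough n → n < d + f →
                      SmallestFactorOf n (smallestFactor f d n)
smallestFactor-spec zero d n 2≤n _ d-rough n<d+0 =
  ⊥-elim (<⇒≱ n<d+0 (subst (_≤ n) (sym (+-identityʳ d)) (rough⇒≤ {{n>1⇒nonTrivial 2≤n}} d-rough)))
smallestFactor-spec (suc f) d n 2≤n 2≤d d-rough n<d+f with d ∣? n
... | yes d∣n = d∣n , 2≤d , d-rough
... | no  d∤n = smallestFactor-spec f (suc d) n 2≤n (m≤n⇒m≤1+n 2≤d) (∤⇒rough-suc d∤n d-rough)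
                                   (subst (n <_) (+-suc d f) n<d+f)

smallestPrimeFactor-spec : ∀ {n} → 2 ≤ n → SmallestFactorOf n (smallestPrimeFactor n)
smallestPrimeFactor-spec {n} 2≤n = smallestFactor-spec n 2 n 2≤n ≤-refl 2-rough (≤-trans (n<1+n n) (n≤1+n (suc n)))

SmallestFactorOf-unique : ∀ {n p r} → SmallestFactorOf n p → SmallestFactorOf n r → p ≡ r
SmallestFactorOf-unique {p = p} {r} (p∣n , 2≤p , p-rough) (r∣n , 2≤r , r-rough) with <-cmp p r
... | tri< p<r _ _ = ⊥-elim (r-rough (hasNonTrivialDivisor {{n>1⇒nonTrivial 2≤p}} p<r p∣n))
... | tri≈ _ p≡r _ = p≡r
... | tri> _ _ r<p = ⊥-elim (p-rough (hasNonTrivialDivisor {{n>1⇒nonTrivial 2≤r}} r<p r∣n))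

smallestPrimeFactor-prime : ∀ {n} → 2 ≤ n → Prime (smallestPrimeFactor n)
smallestPrimeFactor-prime 2≤n with smallestPrimeFactor-spec 2≤n
... | p∣n , 2≤p , p-rough = rough∧∣⇒prime {{n>1⇒nonTrivial 2≤p}} p-rough p∣n

jacobiAux-small : ∀ f a q → q < 2 → jacobiAux f a q ≡ 1ℤ
jacobiAux-small zero    a q _   = refl
jacobiAux-small (suc f) a q q<2 with 2 ≤? q
... | yes 2≤q = ⊥-elim (<⇒≱ q<2 2≤q)
... | no  _   = refl

jacobiAux-step : ∀ f a q p .{{_ : NonZero p}} → 2 ≤ q → smallestPrimeFactor q ≡ p →
                 jacobiAux (suc f) a q ≡ legendre a p ℤ.* jacobiAux f a (q / p)
jacobiAux-step f a q p 2≤q spf≡p with 2 ≤? q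
... | no 2≰q = ⊥-elim (2≰q 2≤q)
... | yes _ with smallestFactor q 2 q | spf≡p
...   | suc _ | refl = refl

jacobiAux-fuel : ∀ f f′ a q → q ≤ f → q ≤ f′ → jacobiAux f a q ≡ jacobiAux f′ a q
jacobiAux-fuel f f′ a q q≤f q≤f′ with q <? 2
... | yes q<2 = trans (jacobiAux-small f a q q<2) (sym (jacobiAux-small f′ a q q<2))
jacobiAux-fuel (suc f) (suc f′) a q q≤f q≤f′ | no q≮2 =
  trans (jacobiAux-step f a q p 2≤q refl)
        (trans (cong (ℤ._*_ (legendre a p)) (jacobiAux-fuel f f′ a (q / p) (fits q≤f) (fits q≤f′)))
               (sym (jacobiAux-step f′ a q p 2≤q refl)))
  where
  2≤q : 2 ≤ q
  2≤q = ≮⇒≥ q≮2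
  p : ℕ
  p = smallestPrimeFactor q
  2≤p : 2 ≤ p
  2≤p = proj₁ (proj₂ (smallestPrimeFactor-spec 2≤q))
  instance
    q≢0 : NonZero q
    q≢0 = ≥2⇒nonZero 2≤q
    p≢0 : NonZero p
    p≢0 = ≥2⇒nonZero 2≤p
  fits : ∀ {g} → q ≤ suc g → q / p ≤ g
  fits q≤1+g = ≤-pred (≤-trans (m/n<m q p 2≤p) q≤1+g)
jacobiAux-fuel zero _ a q q≤0 _ | no q≮2 = ⊥-elim (q≮2 (≤-<-trans q≤0 z<s))
jacobiAux-fuel _ zero a q _ q≤0 | no q≮2 = ⊥-elim (q≮2 (≤-<-trans q≤0 z<s))

jacobi-unfold : ∀ a q p .{{_ : NonZero p}} → 2 ≤ q → smallestPrimeFactor q ≡ p →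
                jacobi a q ≡ legendre a p ℤ.* jacobi a (q / p)
jacobi-unfold a q@(suc q′) p 2≤q spf≡p =
  trans (jacobiAux-step q′ a q p 2≤q spf≡p)
        (cong (ℤ._*_ (legendre a p)) (jacobiAux-fuel q′ (q / p) a (q / p) (≤-pred (m/n<m q p 2≤p)) ≤-refl))
  where
  2≤p : 2 ≤ p
  2≤p = subst (2 ≤_) spf≡p (proj₁ (proj₂ (smallestPrimeFactor-spec 2≤q)))

legendre-cong : ∀ p .{{_ : NonZero p}} {a b} → Congruence._≈_ p a b → legendre a p ≡ legendre b p
legendre-cong p@(suc _) {a} {b} (Congruence.mk a≡b) with p ∣? a | p ∣? b
... | yes _   | yes _   = refl
... | yes p∣a | no  p∤b = ⊥-elim (p∤b (m%n≡0⇒n∣m b p (trans (sym a≡b) (n∣m⇒m%n≡0 a p p∣a))))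
... | no  p∤a | yes p∣b = ⊥-elim (p∤a (m%n≡0⇒n∣m a p (trans a≡b (n∣m⇒m%n≡0 b p p∣b))))
... | no  _   | no  _
  with any? (λ y → y * y % p ≟ a % p) (upTo p) | any? (λ y → y * y % p ≟ b % p) (upTo p)
...   | yes _ | yes _ = refl
...   | no  _ | no  _ = refl
...   | yes a-square | no b-nonsquare = ⊥-elim (b-nonsquare (Any.map (λ e → trans e a≡b) a-square))
...   | no a-nonsquare | yes b-square = ⊥-elim (a-nonsquare (Any.map (λ e → trans e (sym a≡b)) b-square))

data LegendreView (p c : ℕ) .{{_ : NonZero p}} : ℤ → Set where
  divisible  : p ∣ c → LegendreView p c 0ℤ
  residue    : ¬ p ∣ c → ∀ {y} → y < p → y * y % p ≡ c % p → LegendreView p c 1ℤ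
  nonresidue : ¬ p ∣ c → (∀ {y} → y < p → y * y % p ≢ c % p) → LegendreView p c -1ℤ

legendre-view : ∀ p .{{_ : NonZero p}} c → LegendreView p c (legendre c p)
legendre-view p@(suc _) c with p ∣? c
... | yes p∣c = divisible p∣c
... | no  p∤c with any? (λ y → y * y % p ≟ c % p) (upTo p)
...   | yes square = let y , y∈ , e = find square in residue p∤c (∈-upTo⁻ y∈) e
...   | no  ¬square = nonresidue p∤c (λ y<p e → ¬square (lose (∈-upTo⁺ y<p) e))

ZeroOrUnit : ℤ → Set
ZeroOrUnit x = x ≡ 0ℤ ⊎ x ≡ 1ℤ ⊎ x ≡ -1ℤ

legendre-zeroOrUnit : ∀ p .{{_ : NonZero p}} c → ZeroOrUnit (legendre c p)
legendre-zeroOrUnit p c with legendre c p | legendre-view p c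
... | _ | divisible _      = inj₁ refl
... | _ | residue _ _ _    = inj₂ (inj₁ refl)
... | _ | nonresidue _ _   = inj₂ (inj₂ refl)

jacobi-cong : ∀ q .{{_ : NonZero q}} {a b} → Congruence._≈_ q a b → jacobi a q ≡ jacobi b q
jacobi-cong = <-rec _ step
  where
  Goal : ℕ → Set
  Goal q = .{{_ : NonZero q}} → ∀ {a b} → Congruence._≈_ q a b → jacobi a q ≡ jacobi b q
  step : ∀ q → (∀ {r} → r < q → Goal r) → Goal q
  step q ih {a} {b} a≈b with q <? 2
  ... | yes q<2 = trans (jacobiAux-small q a q q<2) (sym (jacobiAux-small q b q q<2))
  ... | no  q≮2 = begin
    jacobi a q                          ≡⟨ jacobi-unfold a q p 2≤q refl ⟩
    legendre a p ℤ.* jacobi a (q / p)   ≡⟨ cong₂ ℤ._*_ (legendre-cong p (≈-mod-∣ p∣q a≈b))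
                                                       (ih (m/n<m q p 2≤p) (≈-mod-∣ (m/n∣m p∣q) a≈b)) ⟩
    legendre b p ℤ.* jacobi b (q / p)   ≡⟨ jacobi-unfold b q p 2≤q refl ⟨
    jacobi b q                          ∎
    where
    open ≡-Reasoning
    2≤q : 2 ≤ q
    2≤q = ≮⇒≥ q≮2
    p : ℕ
    p = smallestPrimeFactor q
    p∣q : p ∣ q
    p∣q = proj₁ (smallestPrimeFactor-spec 2≤q)
    2≤p : 2 ≤ p
    2≤p = proj₁ (proj₂ (smallestPrimeFactor-spec 2≤q))
    instance
      p≢0 : NonZero p
      p≢0 = ≥2⇒nonZero 2≤p
      q/p≢0 : NonZero (q / p)
      q/p≢0 = >-nonZero (m≥n⇒m/n>0 (∣⇒≤ p∣q))

jacobi-prime-power : ∀ a p .{{_ : NonZero p}} j m → 2 ≤ p → 1 ≤ m → p Rough (p ^ j * m) →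
                     jacobi a (p ^ j * m) ≡ legendre a p ℤ.^ j ℤ.* jacobi a m
jacobi-prime-power a p zero m _ _ _ = trans (cong (jacobi a) (+-identityʳ m)) (sym (ℤ.*-identityˡ _))
jacobi-prime-power a p (suc j) m 2≤p 1≤m p-rough = begin
  jacobi a (p * p ^ j * m)
    ≡⟨ cong (jacobi a) (*-assoc p (p ^ j) m) ⟩
  jacobi a (p * X)
    ≡⟨ jacobi-unfold a (p * X) p 2≤pX spf≡p ⟩
  legendre a p ℤ.* jacobi a (p * X / p)
    ≡⟨ cong (λ n → legendre a p ℤ.* jacobi a n) (trans (cong (_/ p) (*-comm p X)) (m*n/n≡m X p)) ⟩
  legendre a p ℤ.* jacobi a X
    ≡⟨ cong (ℤ._*_ (legendre a p)) (jacobi-prime-power a p j m 2≤p 1≤m X-rough) ⟩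
  legendre a p ℤ.* (legendre a p ℤ.^ j ℤ.* jacobi a m)
    ≡⟨ ℤ.*-assoc (legendre a p) _ _ ⟨
  legendre a p ℤ.^ suc j ℤ.* jacobi a m ∎
  where
  open ≡-Reasoning
  X : ℕ
  X = p ^ j * m
  pX-rough : p Rough (p * X)
  pX-rough = subst (p Rough_) (*-assoc p (p ^ j) m) p-rough
  X-rough : p Rough X
  X-rough = rough∧∣⇒rough pX-rough (n∣m*n p)
  2≤pX : 2 ≤ p * X
  2≤pX = subst (_≤ p * X) (*-identityʳ 2) (*-mono-≤ 2≤p (*-mono-≤ (m^n>0 p j) 1≤m))
  spf≡p : smallestPrimeFactor (p * X) ≡ p
  spf≡p = SmallestFactorOf-unique (smallestPrimeFactor-spec 2≤pX) (m∣m*n X , 2≤p , pX-rough)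

∣zeroOrUnit∣≤1 : ∀ {x} → ZeroOrUnit x → ∣ x ∣ ≤ 1
∣zeroOrUnit∣≤1 (inj₁ refl)        = z≤n
∣zeroOrUnit∣≤1 (inj₂ (inj₁ refl)) = ≤-refl
∣zeroOrUnit∣≤1 (inj₂ (inj₂ refl)) = ≤-refl

∣jacobiAux∣≤1 : ∀ f a q → ∣ jacobiAux f a q ∣ ≤ 1
∣jacobiAux∣≤1 zero    a q = ≤-refl
∣jacobiAux∣≤1 (suc f) a q with 2 ≤? q
... | no  _ = ≤-refl
... | yes _ with smallestFactor q 2 q
...   | zero   = ≤-refl
...   | suc p′ = subst (_≤ 1) (sym (ℤ.abs-* (legendre a (suc p′)) _))
                   (*-mono-≤ (∣zeroOrUnit∣≤1 (legendre-zeroOrUnit (suc p′) a))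
                             (∣jacobiAux∣≤1 f a (q / suc p′)))

∣jacobi∣≤1 : ∀ a q → ∣ jacobi a q ∣ ≤ 1
∣jacobi∣≤1 a q = ∣jacobiAux∣≤1 q a q

-- The Legendre sum of 4n² + 1

F : ℕ → ℕ
F n = 4 * n ^ 2 + 1

F-square : ∀ n → F n ≡ 4 * (n * n) + 1
F-square n = cong (λ k → 4 * (n * k) + 1) (*-identityʳ n)

F-cong : ∀ c .{{_ : NonZero c}} {x y} → Congruence._≈_ c x y → Congruence._≈_ c (F x) (F y)
F-cong c x≈y = ≈-+ʳ 1 (≈-*ˡ 4 (≈-* x≈y (≈-*ʳ 1 x≈y)))
  where open Congruence c

module _ {p : ℕ} (p-prime : Prime p) (p-odd : Odd p) where
  private instance
    p≢0 : NonZero p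
    p≢0 = prime⇒nonZero p-prime

  open Congruence p

  2<p : 2 < p
  2<p with m≤n⇒m<n∨m≡n (nonTrivial⇒n>1 p {{prime⇒nonTrivial p-prime}})
  ... | inj₁ 2<p = 2<p
  ... | inj₂ 2≡p = contradiction (trans (cong (_% 2) 2≡p) p-odd) λ ()

  coprime-below : ∀ {u} → 0 < u → u < p → Coprime p u
  coprime-below {suc _} _ u<p = prime⇒coprime p-prime u<p

  0≉1 : ¬ 0 ≈ 1
  0≉1 (mk 0≡1) = 0≢1+n (begin
    0       ≡⟨ m<n⇒m%n≡m (>-nonZero⁻¹ p) ⟨
    0 % p   ≡⟨ 0≡1 ⟩
    1 % p   ≡⟨ m<n⇒m%n≡m (<-trans (s<s z<s) 2<p) ⟩
    1       ∎)
    where open ≡-Reasoning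

  p∣square⇒≡0 : ∀ {y} → y < p → p ∣ y * y → y ≡ 0
  p∣square⇒≡0 {y} y<p p∣y² with euclidsLemma y y p-prime p∣y²
  ... | inj₁ p∣y = ∣∧<⇒≡0 y<p p∣y
  ... | inj₂ p∣y = ∣∧<⇒≡0 y<p p∣y

  square-roots-≥ : ∀ {y z} → z ≤ y → y < p → y * y ≈ z * z → y ≡ z ⊎ y + z ≡ p
  square-roots-≥ {z = z} z≤y y<p y²≈z² with m≤n⇒∃[o]m+o≡n z≤y
  ... | d , refl = roots (euclidsLemma d (z + d + z) p-prime p∣d[y+z])
    where
    expand : ∀ z d → (z + d) * (z + d) ≡ d * (z + d + z) + z * z
    expand = solve-∀
    p∣d[y+z] : p ∣ d * (z + d + z)
    p∣d[y+z] = ≈0⇒∣ (≈-cancelʳ-+ (z * z) (≈-trans (≡⇒≈ (sym (expand z d))) y²≈z²))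
    roots : (p ∣ d) ⊎ (p ∣ z + d + z) → z + d ≡ z ⊎ z + d + z ≡ p
    roots (inj₁ p∣d) =
      inj₁ (trans (cong (z +_) (∣∧<⇒≡0 (≤-<-trans (m≤n+m d z) y<p) p∣d)) (+-identityʳ z))
    roots (inj₂ p∣y+z) with ∣∧<2*⇒≡0⊎≡ (+-mono-< y<p (≤-<-trans z≤y y<p)) p∣y+z
    ... | inj₂ y+z≡p = inj₂ y+z≡p
    ... | inj₁ y+z≡0 = inj₁ (trans (m+n≡0⇒m≡0 (z + d) y+z≡0) (sym (m+n≡0⇒n≡0 (z + d) y+z≡0)))

  square-roots : ∀ {y z} → y < p → z < p → y * y ≈ z * z → y ≡ z ⊎ y + z ≡ p
  square-roots {y} {z} y<p z<p y²≈z² with ≤-total z y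
  ... | inj₁ z≤y = square-roots-≥ z≤y y<p y²≈z²
  ... | inj₂ y≤z with square-roots-≥ y≤z z<p (≈-sym y²≈z²)
  ...   | inj₁ z≡y   = inj₁ (sym z≡y)
  ...   | inj₂ z+y≡p = inj₂ (trans (+-comm y z) z+y≡p)

  sum≡p⇒squares-≈ : ∀ {y z} → y + z ≡ p → y * y ≈ z * z
  sum≡p⇒squares-≈ {y} {z} y+z≡p = ≈-cancelʳ-+ (y * z) (begin
    y * y + y * z   ≡⟨ *-distribˡ-+ y y z ⟨
    y * (y + z)     ≈⟨ ≈-*ˡ y y+z≈0 ⟩
    y * 0           ≡⟨ *-zeroʳ y ⟩
    0               ≡⟨ *-zeroʳ z ⟨
    z * 0           ≈⟨ ≈-*ˡ z y+z≈0 ⟨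
    z * (y + z)     ≡⟨ trans (*-distribˡ-+ z y z) (+-comm (z * y) (z * z)) ⟩
    z * z + z * y   ≡⟨ cong (z * z +_) (*-comm z y) ⟩
    z * z + y * z   ∎)
    where
    open ≈-Reasoning
    y+z≈0 : y + z ≈ 0
    y+z≈0 = ∣⇒≈0 (∣-reflexive (sym y+z≡p))

  rootCount : ℕ → ℤ
  rootCount c = sum p (λ y → indicator (y * y ≈? c))

  rootCount-divisible : ∀ {c} → p ∣ c → rootCount c ≡ 1ℤ
  rootCount-divisible {c} p∣c =
    sum-indicator-unique p (λ y → y * y ≈? c) (>-nonZero⁻¹ p) (≈-sym (∣⇒≈0 p∣c))
      (λ y<p y²≈c → p∣square⇒≡0 y<p (≈0⇒∣ (≈-trans y²≈c (∣⇒≈0 p∣c))))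

  rootCount-nonresidue : ∀ {c} → (∀ {y} → y < p → ¬ y * y ≈ c) → rootCount c ≡ 0ℤ
  rootCount-nonresidue {c} nonsquare = sum-zero p _ (λ y y<p → indicator-no (y * y ≈? c) (nonsquare y<p))

  rootCount-residue : ∀ {c y₀} → ¬ p ∣ c → y₀ < p → y₀ * y₀ ≈ c → rootCount c ≡ ℤ.+ 2
  rootCount-residue {c} {y₀} p∤c y₀<p y₀²≈c =
    trans (sum-pair p _ y₀ y₁ y₀<p y₁<p y₀≢y₁
             (λ y y<p y≢y₀ y≢y₁ → indicator-no (y * y ≈? c) (other y<p y≢y₀ y≢y₁)))
          (cong₂ ℤ._+_ (indicator-yes (y₀ * y₀ ≈? c) y₀²≈c) (indicator-yes (y₁ * y₁ ≈? c) y₁²≈c))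
    where
    y₁ : ℕ
    y₁ = p ∸ y₀
    y₀+y₁≡p : y₀ + y₁ ≡ p
    y₀+y₁≡p = m+[n∸m]≡n (<⇒≤ y₀<p)
    y₁²≈c : y₁ * y₁ ≈ c
    y₁²≈c = ≈-trans (≈-sym (sum≡p⇒squares-≈ {y₀} {y₁} y₀+y₁≡p)) y₀²≈c
    y₀≢0 : y₀ ≢ 0
    y₀≢0 refl = p∤c (≈0⇒∣ (≈-sym y₀²≈c))
    y₁<p : y₁ < p
    y₁<p = ∸-monoʳ-< (n≢0⇒n>0 y₀≢0) (<⇒≤ y₀<p)
    y₀≢y₁ : y₀ ≢ y₁
    y₀≢y₁ y₀≡y₁ = 0≢1+n (trans (sym (m*n%n≡0 y₀ 2)) (trans (cong (_% 2) double) p-odd))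
      where
      double : y₀ * 2 ≡ p
      double = trans (*-comm y₀ 2) (trans (cong (y₀ +_) (trans (+-identityʳ y₀) y₀≡y₁)) y₀+y₁≡p)
    other : ∀ {y} → y < p → y ≢ y₀ → y ≢ y₁ → ¬ y * y ≈ c
    other {y} y<p y≢y₀ y≢y₁ y²≈c with square-roots y<p y₀<p (≈-trans y²≈c (≈-sym y₀²≈c))
    ... | inj₁ y≡y₀   = y≢y₀ y≡y₀
    ... | inj₂ y+y₀≡p = y≢y₁ (trans (sym (m+n∸n≡m y y₀)) (cong (_∸ y₀) y+y₀≡p))

  legendre≡rootCount-1 : ∀ c → legendre c p ≡ rootCount c ℤ.- 1ℤ
  legendre≡rootCount-1 c with legendre c p | legendre-view p c
  ... | _ | divisible p∣c             = sym (cong (ℤ._- 1ℤ) (rootCount-divisible p∣c))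
  ... | _ | residue p∤c y<p y²≡c      = sym (cong (ℤ._- 1ℤ) (rootCount-residue p∤c y<p (mk y²≡c)))
  ... | _ | nonresidue _ nonsquare    = sym (cong (ℤ._- 1ℤ) (rootCount-nonresidue (λ y<p → nonsquare y<p ∘ un)))

  -- Since y² − 4n² = (y − 2n)(y + 2n), the solutions of y² ≡ 4n² + 1 correspond, via u = y − 2n,
  -- to the solutions of the unit equation u (u + 4n) ≡ 1.
  Param : ℕ → ℕ → ℕ → Set
  Param u n y = u + 2 * n ≈ y × u * (y + 2 * n) ≈ 1

  param? : ∀ u n y → Dec (Param u n y)
  param? u n y = (u + 2 * n ≈? y) ×-dec (u * (y + 2 * n) ≈? 1)

  param⇒square : ∀ {u n y} → Param u n y → y * y ≈ F n
  param⇒square {u} {n} {y} (u+2n≈y , u[y+2n]≈1) = begin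
    y * y                                   ≈⟨ ≈-* u+2n≈y u+2n≈y ⟨
    (u + 2 * n) * (u + 2 * n)               ≡⟨ expand u n ⟩
    4 * (n * n) + u * (u + 2 * n + 2 * n)   ≈⟨ ≈-+ˡ (4 * (n * n)) (≈-*ˡ u (≈-+ʳ (2 * n) u+2n≈y)) ⟩
    4 * (n * n) + u * (y + 2 * n)           ≈⟨ ≈-+ˡ (4 * (n * n)) u[y+2n]≈1 ⟩
    4 * (n * n) + 1                         ≡⟨ F-square n ⟨
    F n                                     ∎
    where
    open ≈-Reasoning
    expand : ∀ u n → (u + 2 * n) * (u + 2 * n) ≡ 4 * (n * n) + u * (u + 2 * n + 2 * n)
    expand = solve-∀

  square⇒param : ∀ {n y} → y * y ≈ F n → Param ((y + neg (2 * n)) % p) n y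
  square⇒param {n} {y} y²≈Fn = u+2n≈y , ≈-cancelʳ-+ (2 * n * (y + 2 * n)) (begin
    u * (y + 2 * n) + 2 * n * (y + 2 * n)   ≡⟨ *-distribʳ-+ (y + 2 * n) u (2 * n) ⟨
    (u + 2 * n) * (y + 2 * n)               ≈⟨ ≈-*ʳ (y + 2 * n) u+2n≈y ⟩
    y * (y + 2 * n)                         ≡⟨ *-distribˡ-+ y y (2 * n) ⟩
    y * y + y * (2 * n)                     ≈⟨ ≈-+ʳ (y * (2 * n)) y²≈Fn ⟩
    F n + y * (2 * n)                       ≡⟨ cong (_+ y * (2 * n)) (F-square n) ⟩
    4 * (n * n) + 1 + y * (2 * n)           ≡⟨ regroup n y ⟩
    1 + 2 * n * (y + 2 * n)                 ∎)
    where
    open ≈-Reasoning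
    u : ℕ
    u = (y + neg (2 * n)) % p
    u+2n≈y : u + 2 * n ≈ y
    u+2n≈y = begin
      u + 2 * n                 ≈⟨ ≈-+ʳ (2 * n) (%-≈ (y + neg (2 * n))) ⟩
      y + neg (2 * n) + 2 * n   ≡⟨ trans (+-assoc y _ _) (cong (y +_) (+-comm (neg (2 * n)) (2 * n))) ⟩
      y + (2 * n + neg (2 * n)) ≈⟨ ≈-+ˡ y (+-neg-≈0 (2 * n)) ⟩
      y + 0                     ≡⟨ +-identityʳ y ⟩
      y                         ∎
    regroup : ∀ n y → 4 * (n * n) + 1 + y * (2 * n) ≡ 1 + 2 * n * (y + 2 * n)
    regroup = solve-∀

  indicator-square≡sum-param : ∀ n y → indicator (y * y ≈? F n) ≡ sum p (λ u → indicator (param? u n y))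
  indicator-square≡sum-param n y with y * y ≈? F n
  ... | no ¬square =
    sym (sum-zero p _ (λ u _ → indicator-no (param? u n y) (¬square ∘ param⇒square {u} {n} {y})))
  ... | yes square = sym (sum-indicator-unique p (λ u → param? u n y) (m%n<n _ p) param₀
      (λ u<p param → ≈-<-injective u<p (m%n<n _ p)
                       (≈-cancelʳ-+ (2 * n) (≈-trans (proj₁ param) (≈-sym (proj₁ param₀))))))
    where
    param₀ : Param ((y + neg (2 * n)) % p) n y
    param₀ = square⇒param {n} {y} square

  sum-param≡indicator-unit : ∀ u n → sum p (λ y → indicator (param? u n y)) ≡ indicator (u * (u + 4 * n) ≈? 1)
  sum-param≡indicator-unit u n =
    trans (sum-single p _ y₀ (m%n<n _ p)
             (λ y y<p y≢y₀ → indicator-no (param? u n y) (y≢y₀ ∘ forced y<p)))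
          (indicator-cong (param? u n y₀) (u * (u + 4 * n) ≈? 1)
            (λ param → ≈-trans (≈-*ˡ u (≈-sym y₀+2n≈u+4n)) (proj₂ param))
            (λ unit → ≈-sym (%-≈ (u + 2 * n)) , ≈-trans (≈-*ˡ u y₀+2n≈u+4n) unit))
    where
    y₀ : ℕ
    y₀ = (u + 2 * n) % p
    forced : ∀ {y} → y < p → Param u n y → y ≡ y₀
    forced y<p param =
      ≈-<-injective y<p (m%n<n _ p) (≈-trans (≈-sym (proj₁ param)) (≈-sym (%-≈ (u + 2 * n))))
    y₀+2n≈u+4n : y₀ + 2 * n ≈ u + 4 * n
    y₀+2n≈u+4n = begin
      (u + 2 * n) % p + 2 * n   ≈⟨ ≈-+ʳ (2 * n) (%-≈ (u + 2 * n)) ⟩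
      u + 2 * n + 2 * n         ≡⟨ +-assoc u (2 * n) (2 * n) ⟩
      u + (2 * n + 2 * n)       ≡⟨ cong (u +_) (*-distribʳ-+ n 2 2) ⟨
      u + 4 * n                 ∎
      where open ≈-Reasoning

  unit-solution-unique : ∀ {u n n′} → 0 < u → u < p → n < p → n′ < p →
                         u * (u + 4 * n) ≈ 1 → u * (u + 4 * n′) ≈ 1 → n ≡ n′
  unit-solution-unique {u} {n} {n′} 0<u u<p n<p n′<p unit unit′ = ≈-<-injective n<p n′<p
    (cancel-4 (≈-cancelˡ-+ u (≈-cancelˡ-* (coprime-below 0<u u<p) (≈-trans unit (≈-sym unit′)))))
    where
    cancel-2 : ∀ {x y} → 2 * x ≈ 2 * y → x ≈ y
    cancel-2 = ≈-cancelˡ-* (coprime-below z<s 2<p)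
    cancel-4 : ∀ {x y} → 4 * x ≈ 4 * y → x ≈ y
    cancel-4 {x} {y} 4x≈4y = cancel-2 (cancel-2 (begin
      2 * (2 * x)   ≡⟨ *-assoc 2 2 x ⟨
      4 * x         ≈⟨ 4x≈4y ⟩
      4 * y         ≡⟨ *-assoc 2 2 y ⟩
      2 * (2 * y)   ∎))
      where open ≈-Reasoning

  -- The solution is n = (u⁻¹ − u) / 4, and 1/4 = w² for the inverse w of 2.
  unit-solution : ∀ {u} → 0 < u → u < p → ∃[ n ] n < p × u * (u + 4 * n) ≈ 1
  unit-solution {u} 0<u u<p = t * (w * w) % p , m%n<n _ p , (begin
    u * (u + 4 * (t * (w * w) % p))   ≈⟨ ≈-*ˡ u (≈-+ˡ u (≈-*ˡ 4 (%-≈ (t * (w * w))))) ⟩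
    u * (u + 4 * (t * (w * w)))       ≡⟨ cong (λ k → u * (u + k)) (regroup t w) ⟩
    u * (u + t * (2 * w * (2 * w)))   ≈⟨ ≈-*ˡ u (≈-+ˡ u (≈-*ˡ t (≈-* 2w≈1 2w≈1))) ⟩
    u * (u + t * 1)                   ≡⟨ cong (λ k → u * (u + k)) (*-identityʳ t) ⟩
    u * (u + (neg u + v))             ≡⟨ cong (u *_) (+-assoc u (neg u) v) ⟨
    u * (u + neg u + v)               ≈⟨ ≈-*ˡ u (≈-+ʳ v (+-neg-≈0 u)) ⟩
    u * v                             ≈⟨ uv≈1 ⟩
    1                                 ∎)
    where
    open ≈-Reasoning
    v w t : ℕ
    v = proj₁ (≈-inverse (coprime-below 0<u u<p))
    w = proj₁ (≈-inverse (coprime-below z<s 2<p))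
    t = neg u + v
    uv≈1 : u * v ≈ 1
    uv≈1 = proj₂ (≈-inverse (coprime-below 0<u u<p))
    2w≈1 : 2 * w ≈ 1
    2w≈1 = proj₂ (≈-inverse (coprime-below z<s 2<p))
    regroup : ∀ t w → 4 * (t * (w * w)) ≡ t * (2 * w * (2 * w))
    regroup = solve-∀

  unitSolutions : ℕ → ℤ
  unitSolutions u = sum p (λ n → indicator (u * (u + 4 * n) ≈? 1))

  unitSolutions≡1 : ∀ {u} → 0 < u → u < p → unitSolutions u ≡ 1ℤ
  unitSolutions≡1 {u} 0<u u<p =
    let n₀ , n₀<p , unit₀ = unit-solution 0<u u<p in
    sum-indicator-unique p (λ n → u * (u + 4 * n) ≈? 1) n₀<p unit₀
      (λ n<p unit → unit-solution-unique 0<u u<p n<p n₀<p unit unit₀)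

  [u≡0]+unitSolutions≡1 : ∀ {u} → u < p → indicator (u ≟ 0) ℤ.+ unitSolutions u ≡ 1ℤ
  [u≡0]+unitSolutions≡1 {zero}  _   = cong (ℤ._+_ 1ℤ) (sum-zero p _ (λ n _ → indicator-no (0 ≈? 1) 0≉1))
  [u≡0]+unitSolutions≡1 {suc u} u<p = trans (ℤ.+-identityˡ _) (unitSolutions≡1 z<s u<p)

  solutionCount : ℤ
  solutionCount = sum p (λ n → rootCount (F n))

  solutionCount≡sum-unitSolutions : solutionCount ≡ sum p unitSolutions
  solutionCount≡sum-unitSolutions = begin
    sum p (λ n → sum p (λ y → indicator (y * y ≈? F n)))
      ≡⟨ sum-cong p (λ n _ → sum-cong p (λ y _ → indicator-square≡sum-param n y)) ⟩
    sum p (λ n → sum p (λ y → sum p (λ u → indicator (param? u n y))))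
      ≡⟨ sum-cong p (λ n _ → sum-comm p p _) ⟩
    sum p (λ n → sum p (λ u → sum p (λ y → indicator (param? u n y))))
      ≡⟨ sum-comm p p _ ⟩
    sum p (λ u → sum p (λ n → sum p (λ y → indicator (param? u n y))))
      ≡⟨ sum-cong p (λ u _ → sum-cong p (λ n _ → sum-param≡indicator-unit u n)) ⟩
    sum p unitSolutions ∎
    where open ≡-Reasoning

  solutionCount+1≡p : solutionCount ℤ.+ 1ℤ ≡ ℤ.+ p
  solutionCount+1≡p = begin
    solutionCount ℤ.+ 1ℤ                                   ≡⟨ cong₂ ℤ._+_ solutionCount≡sum-unitSolutions (sym zeroCount) ⟩
    sum p unitSolutions ℤ.+ sum p [u≡0]                    ≡⟨ ℤ.+-comm (sum p unitSolutions) (sum p [u≡0]) ⟩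
    sum p [u≡0] ℤ.+ sum p unitSolutions                    ≡⟨ sum-distrib-+ p _ _ ⟨
    sum p (λ u → [u≡0] u ℤ.+ unitSolutions u)              ≡⟨ sum-cong p (λ u u<p → [u≡0]+unitSolutions≡1 u<p) ⟩
    sum p (λ _ → 1ℤ)                                       ≡⟨ trans (sum-const p 1ℤ) (ℤ.*-identityʳ (ℤ.+ p)) ⟩
    ℤ.+ p                                                  ∎
    where
    open ≡-Reasoning
    [u≡0] : ℕ → ℤ
    [u≡0] u = indicator (u ≟ 0)
    zeroCount : sum p [u≡0] ≡ 1ℤ
    zeroCount = sum-indicator-unique p (_≟ 0) (>-nonZero⁻¹ p) refl (λ _ u≡0 → u≡0)

  sum-legendre-F : sum p (λ n → legendre (F n) p) ≡ -1ℤ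
  sum-legendre-F = begin
    sum p (λ n → legendre (F n) p)                 ≡⟨ sum-cong p (λ n _ → legendre≡rootCount-1 (F n)) ⟩
    sum p (λ n → rootCount (F n) ℤ.+ -1ℤ)          ≡⟨ sum-distrib-+ p _ _ ⟩
    solutionCount ℤ.+ sum p (λ _ → -1ℤ)            ≡⟨ cong (ℤ._+_ solutionCount) (sum-const p -1ℤ) ⟩
    solutionCount ℤ.+ ℤ.+ p ℤ.* -1ℤ                ≡⟨ cong (λ k → solutionCount ℤ.+ k ℤ.* -1ℤ) solutionCount+1≡p ⟨
    solutionCount ℤ.+ (solutionCount ℤ.+ 1ℤ) ℤ.* -1ℤ ≡⟨ cancel solutionCount ⟩
    -1ℤ                                            ∎
    where
    open ≡-Reasoning
    cancel : ∀ a → a ℤ.+ (a ℤ.+ 1ℤ) ℤ.* -1ℤ ≡ -1ℤ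
    cancel = ℤ-Solver.solve-∀

-- p-adic splittings and square-free parts

p-adic-split : ∀ p → 2 ≤ p → ∀ n → 0 < n → ∃₂ λ k m → n ≡ p ^ k * m × ¬ p ∣ m
p-adic-split p 2≤p = <-rec _ split
  where
  Split : ℕ → Set
  Split n = 0 < n → ∃₂ λ k m → n ≡ p ^ k * m × ¬ p ∣ m
  split : ∀ n → (∀ {n′} → n′ < n → Split n′) → Split n
  split n rec 0<n with p ∣? n
  ... | no  p∤n = 0 , n , sym (*-identityˡ n) , p∤n
  ... | yes (divides zero refl) = ⊥-elim (<-irrefl refl 0<n)
  ... | yes (divides c@(suc _) refl) =
    let k , m , c≡pᵏm , p∤m = rec (m<m*n c p 2≤p) z<s
    in suc k , m , trans (cong (_* p) c≡pᵏm) (regroup (p ^ k) m p) , p∤m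
    where
    regroup : ∀ a m p → a * m * p ≡ p * a * m
    regroup = solve-∀

p-adic-split-unique : ∀ {p} → Prime p → ∀ a b u v → p ^ a * u ≡ p ^ b * v → ¬ p ∣ u → ¬ p ∣ v →
                      a ≡ b × u ≡ v
p-adic-split-unique pr zero zero u v e _ _ = refl , trans (sym (*-identityˡ u)) (trans e (*-identityˡ v))
p-adic-split-unique {p} pr zero (suc b) u v e p∤u _ =
  ⊥-elim (p∤u (divides (p ^ b * v) (trans (sym (*-identityˡ u)) (trans e (trans (*-assoc p _ v) (*-comm p _))))))
p-adic-split-unique {p} pr (suc a) zero u v e _ p∤v =
  ⊥-elim (p∤v (divides (p ^ a * u)
    (trans (sym (*-identityˡ v)) (trans (sym e) (trans (*-assoc p _ u) (*-comm p _))))))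
p-adic-split-unique {p} pr (suc a) (suc b) u v e p∤u p∤v =
  let a≡b , u≡v = p-adic-split-unique pr a b u v cancelled p∤u p∤v in cong suc a≡b , u≡v
  where
  cancelled : p ^ a * u ≡ p ^ b * v
  cancelled = *-cancelˡ-≡ _ _ p {{prime⇒nonZero pr}} (trans (sym (*-assoc p _ u)) (trans e (*-assoc p _ v)))

prime∤⇒coprime-^ : ∀ {p m} → Prime p → ¬ p ∣ m → ∀ k → Coprime (p ^ k) m
prime∤⇒coprime-^ {p} {m} pr p∤m k {d} (d∣pᵏ , d∣m) = ∣1⇒≡1 (descend k d∣pᵏ)
  where
  d⊥p : Coprime d p
  d⊥p {e} (e∣d , e∣p) with prime⇒irreducible pr e∣p
  ... | inj₁ e≡1 = e≡1
  ... | inj₂ refl = ⊥-elim (p∤m (∣-trans e∣d d∣m))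
  descend : ∀ k → d ∣ p ^ k → d ∣ 1
  descend zero    d∣1    = d∣1
  descend (suc k) d∣pᵏ⁺¹ = descend k (coprime-divisor d⊥p d∣pᵏ⁺¹)

SquareFree-∣ : ∀ {d n} → d ∣ n → SquareFree n → SquareFree d
SquareFree-∣ d∣n sf e e*e∣d = sf e (∣-trans e*e∣d d∣n)

prime∤-* : ∀ {p a b} → Prime p → ¬ p ∣ a → ¬ p ∣ b → ¬ p ∣ a * b
prime∤-* {a = a} {b} pr p∤a p∤b p∣ab with euclidsLemma a b pr p∣ab
... | inj₁ p∣a = p∤a p∣a
... | inj₂ p∣b = p∤b p∣b

SquareFree⇒valuation≤1 : ∀ {p e b} → Prime p → SquareFree (p ^ e * b) → e ≡ 0 ⊎ e ≡ 1
SquareFree⇒valuation≤1 {e = zero}        _  _  = inj₁ refl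
SquareFree⇒valuation≤1 {e = suc zero}    _  _  = inj₂ refl
SquareFree⇒valuation≤1 {p} {suc (suc e)} {b} pr sf =
  ⊥-elim (nonTrivial⇒≢1 {{prime⇒nonTrivial pr}} (sf p (divides (p ^ e * b) (regroup p (p ^ e) b))))
  where
  regroup : ∀ p x b → p * (p * x) * b ≡ x * b * (p * p)
  regroup = solve-∀

odd-1+2* : ∀ f → Odd (1 + 2 * f)
odd-1+2* f = trans (cong (λ k → (1 + k) % 2) (*-comm 2 f)) ([m+kn]%n≡m%n 1 f 2)

square-regroup : ∀ p f e a b → (p ^ f * a) ^ 2 * (p ^ e * b) ≡ p ^ (e + 2 * f) * (a ^ 2 * b)
square-regroup p f e a b = begin
  (p ^ f * a) ^ 2 * (p ^ e * b)             ≡⟨ shuffle (p ^ f) (p ^ e) a b ⟩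
  p ^ e * (p ^ f * p ^ f) * (a ^ 2 * b)     ≡⟨ cong (_* (a ^ 2 * b)) power ⟨
  p ^ (e + 2 * f) * (a ^ 2 * b)             ∎
  where
  open ≡-Reasoning
  shuffle : ∀ P E a b → P * a * (P * a * 1) * (E * b) ≡ E * (P * P) * (a * (a * 1) * b)
  shuffle = solve-∀
  power : p ^ (e + 2 * f) ≡ p ^ e * (p ^ f * p ^ f)
  power = trans (^-distribˡ-+-* p e (2 * f))
                (cong (p ^ e *_) (trans (cong (λ j → p ^ (f + j)) (+-identityʳ f)) (^-distribˡ-+-* p f f)))

SquareFreeSplit : ℕ → ℕ → ℕ → ℕ → Set
SquareFreeSplit p k m q₀ = ∃₂ λ a b → m ≡ a ^ 2 * b × SquareFree b × (q₀ ≡ b ⊎ q₀ ≡ p * b × Odd k)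

squareFree-split : ∀ {p k m q₁ q₀} → Prime p → ¬ p ∣ m → p ^ k * m ≡ q₁ ^ 2 * q₀ → SquareFree q₀ →
                   SquareFreeSplit p k m q₀
squareFree-split {p} {k} {m} {q₁} {q₀} pr p∤m pᵏm≡q₁²q₀ sf
  with p-adic-split p 2≤p q₁ (>-nonZero⁻¹ q₁) | p-adic-split p 2≤p q₀ (>-nonZero⁻¹ q₀)
  where
  2≤p : 2 ≤ p
  2≤p = nonTrivial⇒n>1 p {{prime⇒nonTrivial pr}}
  instance
    m≢0 : NonZero m
    m≢0 = ≢-nonZero (λ { refl → p∤m (p ∣0) })
    q≢0 : NonZero (q₁ ^ 2 * q₀)
    q≢0 = subst NonZero pᵏm≡q₁²q₀ (m*n≢0 (p ^ k) m {{m^n≢0 p k {{prime⇒nonZero pr}}}})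
    q₁≢0 : NonZero q₁
    q₁≢0 = m*n≢0⇒m≢0 q₁ {{m*n≢0⇒m≢0 (q₁ ^ 2)}}
    q₀≢0 : NonZero q₀
    q₀≢0 = m*n≢0⇒n≢0 (q₁ ^ 2)
... | f , a , refl , p∤a | e , b , refl , p∤b
  with p-adic-split-unique pr k (e + 2 * f) m (a ^ 2 * b) (trans pᵏm≡q₁²q₀ (square-regroup p f e a b))
         p∤m (prime∤-* pr (prime∤-* pr p∤a (p∤a ∘ subst (p ∣_) (*-identityʳ a))) p∤b)
... | k≡e+2f , m≡a²b =
  a , b , m≡a²b , SquareFree-∣ (n∣m*n (p ^ e)) sf , q₀-cases (SquareFree⇒valuation≤1 pr sf)
  where
  q₀-cases : e ≡ 0 ⊎ e ≡ 1 → p ^ e * b ≡ b ⊎ p ^ e * b ≡ p * b × Odd k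
  q₀-cases (inj₁ refl) = inj₁ (*-identityˡ b)
  q₀-cases (inj₂ refl) = inj₂ (cong (_* b) (*-identityʳ p) , subst Odd (sym k≡e+2f) (odd-1+2* f))

-- The complete sum

completeSum : ℕ → ℤ
completeSum q = sum q (λ n → jacobi (F n) q)

localSum : ℕ → ℕ → ℤ
localSum p k = sum p (λ n → legendre (F n) p ℤ.^ k)

∣zeroOrUnit^∣≤1 : ∀ {x} → ZeroOrUnit x → ∀ k → ∣ x ℤ.^ k ∣ ≤ 1
∣zeroOrUnit^∣≤1 _ zero = ≤-refl
∣zeroOrUnit^∣≤1 {x} x∈ (suc k) =
  subst (_≤ 1) (sym (ℤ.abs-* x (x ℤ.^ k))) (*-mono-≤ (∣zeroOrUnit∣≤1 x∈) (∣zeroOrUnit^∣≤1 x∈ k))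

zeroOrUnit-^-odd : ∀ {x} → ZeroOrUnit x → ∀ {k} → Odd k → x ℤ.^ k ≡ x
zeroOrUnit-^-odd {x} x∈ {k} k-odd = trans (cong (x ℤ.^_) k≡1+2h) (^-1+2* x∈ (k / 2))
  where
  k≡1+2h : k ≡ suc (2 * (k / 2))
  k≡1+2h = trans (m≡m%n+[m/n]*n k 2) (cong₂ _+_ k-odd (*-comm (k / 2) 2))
  ^-1+2* : ∀ {x} → ZeroOrUnit x → ∀ h → x ℤ.^ suc (2 * h) ≡ x
  ^-1+2* (inj₁ refl)        h = ℤ.*-zeroˡ (0ℤ ℤ.^ (2 * h))
  ^-1+2* (inj₂ (inj₁ refl)) h = ℤ.^-zeroˡ (suc (2 * h))
  ^-1+2* (inj₂ (inj₂ refl)) h =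
    trans (cong (ℤ._*_ -1ℤ) (trans (sym (ℤ.^-*-assoc -1ℤ 2 h)) (ℤ.^-zeroˡ h))) (ℤ.*-identityʳ -1ℤ)

∣localSum∣≤ : ∀ p .{{_ : NonZero p}} k → ∣ localSum p k ∣ ≤ p
∣localSum∣≤ p k = ∣sum∣≤ p _ (λ n _ → ∣zeroOrUnit^∣≤1 (legendre-zeroOrUnit p (F n)) k)

localSum-odd : ∀ {p k} → Prime p → Odd p → Odd k → localSum p k ≡ -1ℤ
localSum-odd {p} {k} pr p-odd k-odd = trans
  (sum-cong p (λ n _ → zeroOrUnit-^-odd (legendre-zeroOrUnit p {{prime⇒nonZero pr}} (F n)) {k} k-odd))
  (sum-legendre-F pr p-odd)

completeSum-split : ∀ {p} → Prime p → ∀ k m .{{_ : NonZero m}} → ¬ p ∣ m → p Rough (p ^ suc k * m) →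
                    completeSum (p ^ suc k * m) ≡ ℤ.+ (p ^ k) ℤ.* localSum p (suc k) ℤ.* completeSum m
completeSum-split {p} pr k m p∤m p-rough = begin
  sum (p ^ suc k * m) (λ n → jacobi (F n) (p ^ suc k * m))
    ≡⟨ sum-cong (p ^ suc k * m) (λ n _ →
         jacobi-prime-power (F n) p (suc k) m 2≤p (>-nonZero⁻¹ m) p-rough) ⟩
  sum (p ^ suc k * m) (λ n → g n ℤ.* jacobi (F n) m)
    ≡⟨ sum-crt (prime∤⇒coprime-^ pr p∤m (suc k)) g-invariant jacobi-F-invariant ⟩
  sum (p ^ suc k) g ℤ.* completeSum m
    ≡⟨ cong (λ j → sum j g ℤ.* completeSum m) (*-comm p (p ^ k)) ⟩
  sum (p ^ k * p) g ℤ.* completeSum m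
    ≡⟨ cong (ℤ._* completeSum m) (sum-periodic (p ^ k) p g g-periodic) ⟩
  ℤ.+ (p ^ k) ℤ.* localSum p (suc k) ℤ.* completeSum m
    ∎
  where
  open ≡-Reasoning
  instance
    p≢0 : NonZero p
    p≢0 = prime⇒nonZero pr
    pᴷ≢0 : NonZero (p ^ suc k)
    pᴷ≢0 = m^n≢0 p (suc k)
  2≤p : 2 ≤ p
  2≤p = nonTrivial⇒n>1 p {{prime⇒nonTrivial pr}}
  g : ℕ → ℤ
  g n = legendre (F n) p ℤ.^ suc k
  g-invariant-p : Congruence.Invariant p g
  g-invariant-p x≈y = cong (ℤ._^ suc k) (legendre-cong p (F-cong p x≈y))
  g-periodic : Periodic p g
  g-periodic i = g-invariant-p (Congruence.mk ([m+n]%n≡m%n i p))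
  g-invariant : Congruence.Invariant (p ^ suc k) g
  g-invariant x≈y = g-invariant-p (≈-mod-∣ (m∣m*n (p ^ k)) x≈y)
  jacobi-F-invariant : Congruence.Invariant m (λ n → jacobi (F n) m)
  jacobi-F-invariant x≈y = jacobi-cong m (F-cong m x≈y)

odd-∣ : ∀ {d q} → d ∣ q → Odd q → Odd d
odd-∣ {d} {q} d∣q q-odd with d % 2 | m%n<n d 2 | m≡m%n+[m/n]*n d 2
... | 1 | _ | _ = refl
... | suc (suc _) | s<s (s<s ()) | _
... | 0 | _ | d≡[d/2]*2 = ⊥-elim (0≢1+n (trans (sym (n∣m⇒m%n≡0 q 2 (∣-trans 2∣d d∣q))) q-odd))
  where
  2∣d : 2 ∣ d
  2∣d = divides (d / 2) d≡[d/2]*2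

completeSumBound-prime-power : ∀ {p k m q₁ q₀} .{{_ : NonZero m}} → Prime p → Odd p → ¬ p ∣ m →
                               p Rough (p ^ suc k * m) → p ^ suc k * m ≡ q₁ ^ 2 * q₀ → SquareFree q₀ →
                               (∀ {a b} → m ≡ a ^ 2 * b → SquareFree b → ∣ completeSum m ∣ * b ≤ m) →
                               ∣ completeSum (p ^ suc k * m) ∣ * q₀ ≤ p ^ suc k * m
completeSumBound-prime-power {p} {k} {m} {q₁} {q₀} pr p-odd p∤m p-rough pᴷm≡q₁²q₀ sf bound-m
  with squareFree-split {p} {suc k} {m} {q₁} {q₀} pr p∤m pᴷm≡q₁²q₀ sf
... | a , b , m≡a²b , sf-b , q₀-cases = begin
  ∣ completeSum (p ^ suc k * m) ∣ * q₀
    ≡⟨ cong (λ s → ∣ s ∣ * q₀) (completeSum-split pr k m p∤m p-rough) ⟩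
  ∣ ℤ.+ (p ^ k) ℤ.* localSum p (suc k) ℤ.* completeSum m ∣ * q₀
    ≡⟨ cong (_* q₀) (trans (ℤ.abs-* (ℤ.+ (p ^ k) ℤ.* localSum p (suc k)) (completeSum m))
                           (cong (_* P) (ℤ.abs-* (ℤ.+ (p ^ k)) (localSum p (suc k))))) ⟩
  p ^ k * L * P * q₀
    ≤⟨ combine q₀-cases ⟩
  p ^ k * p * m
    ≡⟨ cong (_* m) (*-comm (p ^ k) p) ⟩
  p ^ suc k * m ∎
  where
  open ≤-Reasoning
  instance p≢0 : NonZero p
  p≢0 = prime⇒nonZero pr
  L P : ℕ
  L = ∣ localSum p (suc k) ∣
  P = ∣ completeSum m ∣
  Pb≤m : P * b ≤ m
  Pb≤m = bound-m {a} {b} m≡a²b sf-b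
  combine : q₀ ≡ b ⊎ q₀ ≡ p * b × Odd (suc k) → p ^ k * L * P * q₀ ≤ p ^ k * p * m
  combine (inj₁ refl) = begin
    p ^ k * L * P * b     ≡⟨ *-assoc (p ^ k * L) P b ⟩
    p ^ k * L * (P * b)   ≤⟨ *-mono-≤ (*-monoʳ-≤ (p ^ k) (∣localSum∣≤ p (suc k))) Pb≤m ⟩
    p ^ k * p * m         ∎
  combine (inj₂ (refl , k-odd)) = begin
    p ^ k * L * P * (p * b)   ≡⟨ cong (λ l → p ^ k * ∣ l ∣ * P * (p * b)) (localSum-odd {p} {suc k} pr p-odd k-odd) ⟩
    p ^ k * 1 * P * (p * b)   ≡⟨ regroup (p ^ k) P p b ⟩
    p ^ k * p * (P * b)       ≤⟨ *-monoʳ-≤ (p ^ k * p) Pb≤m ⟩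
    p ^ k * p * m             ∎
    where
    regroup : ∀ A P p b → A * 1 * P * (p * b) ≡ A * p * (P * b)
    regroup = solve-∀

CompleteSumBound : ℕ → Set
CompleteSumBound q = ∀ {q₁ q₀} → Odd q → q ≡ q₁ ^ 2 * q₀ → SquareFree q₀ → ∣ completeSum q ∣ * q₀ ≤ q

completeSumBound-≥2 : ∀ {q} → 2 ≤ q → (∀ {m} → m < q → CompleteSumBound m) → CompleteSumBound q
completeSumBound-≥2 {q} 2≤q rec {q₁} {q₀} q-odd q≡q₁²q₀ sf
  with smallestPrimeFactor-spec 2≤q
... | p∣q , 2≤p , p-rough with p-adic-split (smallestPrimeFactor q) 2≤p q (≤-trans z<s 2≤q)
...   | zero  , m , q≡m   , p∤m = ⊥-elim (p∤m (subst (_ ∣_) (trans q≡m (*-identityˡ m)) p∣q))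
...   | suc k , m , q≡pᴷm , p∤m = subst (λ n → ∣ completeSum n ∣ * q₀ ≤ n) (sym q≡pᴷm)
  (completeSumBound-prime-power {p} {k} {m} {q₁} {q₀} pr (odd-∣ p∣q q-odd) p∤m
     (subst (p Rough_) q≡pᴷm p-rough) (trans (sym q≡pᴷm) q≡q₁²q₀) sf
     (λ {a} {b} → rec m<q {a} {b} (odd-∣ m∣q q-odd)))
  where
  p : ℕ
  p = smallestPrimeFactor q
  pr : Prime p
  pr = smallestPrimeFactor-prime 2≤q
  instance m≢0 : NonZero m
  m≢0 = ≢-nonZero (λ { refl → p∤m (p ∣0) })
  m∣q : m ∣ q
  m∣q = divides (p ^ suc k) q≡pᴷm
  m<q : m < q
  m<q = subst (m <_) (trans (*-comm m (p ^ suc k)) (sym q≡pᴷm))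
              (m<m*n m (p ^ suc k) (≤-trans 2≤p (m≤m*n p (p ^ k) {{m^n≢0 p k {{prime⇒nonZero pr}}}})))

completeSumBound : ∀ q → CompleteSumBound q
completeSumBound = <-rec _ bound
  where
  bound : ∀ q → (∀ {m} → m < q → CompleteSumBound m) → CompleteSumBound q
  bound 0 _ ()
  bound 1 _ {q₁} {q₀} _ 1≡q₁²q₀ _ =
    subst (λ d → ∣ completeSum 1 ∣ * d ≤ 1) (sym (∣1⇒≡1 (divides {q₀} (q₁ ^ 2) 1≡q₁²q₀))) ≤-refl
  bound (suc (suc _)) rec {q₁} {q₀} = completeSumBound-≥2 (s≤s (s≤s z≤n)) rec {q₁} {q₀}

-- The incomplete sum

∣sum∣≤-periodic : ∀ x c .{{_ : NonZero c}} f → Periodic c f → (∀ i → ∣ f i ∣ ≤ 1) →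
                  ∣ sum x f ∣ ≤ x / c * ∣ sum c f ∣ + x % c
∣sum∣≤-periodic x c f per ∣f∣≤1 = begin
  ∣ sum x f ∣                                 ≡⟨ cong (λ n → ∣ sum n f ∣) x≡tc+r ⟩
  ∣ sum (t * c + r) f ∣                       ≡⟨ cong ∣_∣ (sum-+-split (t * c) r f) ⟩
  ∣ sum (t * c) f ℤ.+ sum r tail ∣            ≤⟨ ℤ.∣i+j∣≤∣i∣+∣j∣ (sum (t * c) f) (sum r tail) ⟩
  ∣ sum (t * c) f ∣ + ∣ sum r tail ∣          ≤⟨ +-mono-≤ (≤-reflexive ∣periods∣) (∣sum∣≤ r tail (λ i _ → ∣f∣≤1 _)) ⟩
  t * ∣ sum c f ∣ + r                         ∎
  where
  open ≤-Reasoning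
  t r : ℕ
  t = x / c
  r = x % c
  tail : ℕ → ℤ
  tail i = f (t * c + i)
  x≡tc+r : x ≡ t * c + r
  x≡tc+r = trans (m≡m%n+[m/n]*n x c) (+-comm r (t * c))
  ∣periods∣ : ∣ sum (t * c) f ∣ ≡ t * ∣ sum c f ∣
  ∣periods∣ = trans (cong ∣_∣ (sum-periodic t c f per)) (ℤ.abs-* (ℤ.+ t) (sum c f))

charSum≡sum : ∀ x q → charSum x q ≡ sum x (λ i → jacobi (F (suc i)) q)
charSum≡sum x q = go x id
  where
  go : ∀ n (f : ℕ → ℕ) → foldr ℤ._+_ 0ℤ (map (λ n → jacobi (F n) q) (map suc (applyUpTo f n)))
                         ≡ sum n (λ i → jacobi (F (suc (f i))) q)
  go zero    f = refl
  go (suc n) f = cong (ℤ._+_ (jacobi (F (suc (f 0))) q)) (go n (f ∘ suc))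

∣charSum∣≤ : ∀ x q .{{_ : NonZero q}} → ∣ charSum x q ∣ ≤ x / q * ∣ completeSum q ∣ + x % q
∣charSum∣≤ x q = begin
  ∣ charSum x q ∣
    ≡⟨ cong ∣_∣ (charSum≡sum x q) ⟩
  ∣ sum x (term ∘ suc) ∣
    ≤⟨ ∣sum∣≤-periodic x q (term ∘ suc) (term-periodic ∘ suc) (λ i → ∣jacobi∣≤1 (F (suc i)) q) ⟩
  x / q * ∣ sum q (term ∘ suc) ∣ + x % q
    ≡⟨ cong (λ s → x / q * ∣ s ∣ + x % q) (sum-rotate q term term-periodic) ⟩
  x / q * ∣ completeSum q ∣ + x % q ∎
  where
  open ≤-Reasoning
  term : ℕ → ℤ
  term n = jacobi (F n) q
  term-periodic : Periodic q term
  term-periodic i = jacobi-cong q (F-cong q (Congruence.mk ([m+n]%n≡m%n i q)))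

lemma2p5 : ∃[ C ] ∀ (q q₁ q₀ x : ℕ) → Odd q → q ≡ q₁ ^ 2 * q₀ → SquareFree q₀ → q ^ 2 ≤ x →
             ∣ charSum x q ∣ * q₀ ≤ C * x
lemma2p5 = 2 , bound
  where
  bound : ∀ (q q₁ q₀ x : ℕ) → Odd q → q ≡ q₁ ^ 2 * q₀ → SquareFree q₀ → q ^ 2 ≤ x →
          ∣ charSum x q ∣ * q₀ ≤ 2 * x
  bound q@(suc _) q₁ q₀ x q-odd q≡q₁²q₀ sf q²≤x = begin
    ∣ charSum x q ∣ * q₀
      ≤⟨ *-monoˡ-≤ q₀ (∣charSum∣≤ x q) ⟩
    (x / q * ∣ completeSum q ∣ + x % q) * q₀
      ≡⟨ distribute (x / q) ∣ completeSum q ∣ (x % q) q₀ ⟩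
    x / q * (∣ completeSum q ∣ * q₀) + x % q * q₀
      ≤⟨ +-mono-≤ (*-monoʳ-≤ (x / q) (completeSumBound q {q₁} q-odd q≡q₁²q₀ sf))
                  (*-mono-≤ (<⇒≤ (m%n<n x q)) (∣⇒≤ (divides (q₁ ^ 2) q≡q₁²q₀))) ⟩
    x / q * q + q * q
      ≤⟨ +-mono-≤ (m/n*n≤m x q) (subst (_≤ x) (cong (q *_) (*-identityʳ q)) q²≤x) ⟩
    x + x
      ≡⟨ cong (x +_) (+-identityʳ x) ⟨
    2 * x ∎
    where
    open ≤-Reasoning
    distribute : ∀ t P r b → (t * P + r) * b ≡ t * (P * b) + r * b
    distribute = solve-∀
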